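{- Let $G=(V,E)$ be a simple directed graph, let $C,C'$ be configurations, and let $f_t:V\to C$ and $g_t:V\to C'$ be valuations such that $\alpha$ is an isomorphism of valuations from $f_t$ to $g_t$. Let $v'\in V$, let $f_{t+1}$ be obtained from $f_t$ by one update of the asynchronous maximum model at the vertex $v'$, and let $g_{t+1}$ be obtained from $g_t$ by one update at the vertex $\alpha(v')$. Then $\alpha$ is an isomorphism of valuations from $f_{t+1}$ to $g_{t+1}$; in particular $f_{t+1}\equiv g_{t+1}$.
   Context: A configuration is a non-empty totally ordered set. For a graph $G=(V,E)$ and configuration $C$, a valuation is a function $f:V\to C$. An update of the asynchronous maximum model at a vertex $v'$ sends $f$ to the valuation $f'$ with $f'(v')=\max\{f(u): u\neq v',\ (v',u)\in E\}$ if $v'$ has an out-neighbour ($f'(v')=f(v')$ otherwise) and $f'(v)=f(v)$ for $v\neq v'$. For valuations $f:V\to C$ and $g:V\to C'$, an isomorphism of valuations from $f$ to $g$ is a graph automorphism $\alpha:V\to V$ (a bijection with $(u,v)\in E$ iff $(\alpha(u),\alpha(v))\in E$) such that for all $u,v\in V$: $f(u)<f(v)$ iff $g(\alpha(u))<g(\alpha(v))$, $f(u)=f(v)$ iff $g(\alpha(u))=g(\alpha(v))$, and $f(u)>f(v)$ iff $g(\alpha(u))>g(\alpha(v))$. Write $f\equiv g$ if such an isomorphism exists. -}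

module Defs where

open import Level using (Level; _⊔_)
open import Data.Nat using (ℕ)
open import Data.Fin using (Fin)
open import Data.Product using (Σ; _×_; ∃)
open import Relation.Nullary using (¬_)
open import Relation.Binary.PropositionalEquality using (_≡_)
open import Relation.Binary.Bundles using (StrictTotalOrder)

record SimpleDigraph (n : ℕ) : Set₁ where
  field
    Edge    : Fin n → Fin n → Set
    loopless : ∀ v → ¬ Edge v v

record Configuration (c ℓ₁ ℓ₂ : Level) : Set (Level.suc (c ⊔ ℓ₁ ⊔ ℓ₂)) where
  field
    order    : StrictTotalOrder c ℓ₁ ℓ₂
    nonEmpty : StrictTotalOrder.Carrier order
  open StrictTotalOrder order public

module _ {n : ℕ} (G : SimpleDigraph n) where
  open SimpleDigraph G

  record Automorphism : Set where
    field
      to      : Fin n → Fin n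
      from    : Fin n → Fin n
      to-from : ∀ v → to (from v) ≡ v
      from-to : ∀ v → from (to v) ≡ v
      edge⇔   : ∀ u v → (Edge u v → Edge (to u) (to v)) × (Edge (to u) (to v) → Edge u v)

  module _ {c ℓ₁ ℓ₂ : Level} (C : Configuration c ℓ₁ ℓ₂) where
    open Configuration C

    Valuation : Set c
    Valuation = Fin n → Carrier

    IsMaxOutNeighbour : Valuation → Fin n → Carrier → Set (ℓ₁ ⊔ ℓ₂)
    IsMaxOutNeighbour f v' m =
      (Σ (Fin n) λ u → (¬ u ≡ v') × Edge v' u × (m ≈ f u))
      × (∀ u → ¬ u ≡ v' → Edge v' u → ¬ (m < f u))

    HasOutNeighbour : Fin n → Set
    HasOutNeighbour v' = Σ (Fin n) λ u → (¬ u ≡ v') × Edge v' u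

    record Update (f : Valuation) (v' : Fin n) (f' : Valuation) : Set (ℓ₁ ⊔ ℓ₂) where
      field
        withOut    : HasOutNeighbour v' → IsMaxOutNeighbour f v' (f' v')
        withoutOut : ¬ HasOutNeighbour v' → f' v' ≈ f v'
        others     : ∀ v → ¬ v ≡ v' → f' v ≈ f v

  module _ {c ℓ₁ ℓ₂ c' ℓ₁' ℓ₂' : Level}
           (C : Configuration c ℓ₁ ℓ₂) (C' : Configuration c' ℓ₁' ℓ₂') where
    private
      module C = Configuration C
      module C' = Configuration C'

    IsValuationIso : Automorphism → Valuation C → Valuation C' → Set (ℓ₁ ⊔ ℓ₂ ⊔ ℓ₁' ⊔ ℓ₂')
    IsValuationIso α f g =
      ∀ u v → ((f u C.< f v → g (a u) C'.< g (a v)) × (g (a u) C'.< g (a v) → f u C.< f v))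
            × ((f u C.≈ f v → g (a u) C'.≈ g (a v)) × (g (a u) C'.≈ g (a v) → f u C.≈ f v))
            × ((f v C.< f u → g (a v) C'.< g (a u)) × (g (a v) C'.< g (a u) → f v C.< f u))
      where a = Automorphism.to α

    _≡ᵥ_ : Valuation C → Valuation C' → Set (ℓ₁ ⊔ ℓ₂ ⊔ ℓ₁' ⊔ ℓ₂')
    f ≡ᵥ g = Σ Automorphism λ α → IsValuationIso α f g

-- A maximum update at v' gives v' the value of some vertex w (v' itself when it
-- has no out-neighbour, otherwise an out-neighbour attaining the maximum), and
-- leaves every other vertex alone. The automorphism α maps out-neighbours of v'
-- to out-neighbours of α v' and, being an isomorphism of valuations, maps an
-- out-neighbour of maximal value to one of maximal value; so the update at α v'
-- gives α v' the value of α w. Hence each new pair of values (f' v, g' (α v)) is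
-- an old pair (f w, g (α w)), and comparisons between new pairs are comparisons
-- between old pairs. Whether v' has an out-neighbour is not decidable, so this
-- holds only under double negation, which is harmless because every comparison
-- in a configuration is decidable.
module Submission where

open import Defs
open import Level using (Level; _⊔_)
open import Data.Nat using (ℕ)
open import Data.Fin using (Fin; _≟_)
open import Data.Product using (_×_; _,_; proj₁; proj₂; Σ; ∃)
open import Function using (_∘_)
open import Data.Empty using (⊥-elim)
open import Relation.Nullary using (¬_; Dec; yes; no)
open import Relation.Nullary.Decidable using (decidable-stable; ¬¬-excluded-middle)
open import Relation.Nullary.Negation using (¬¬-map)
open import Relation.Binary.PropositionalEquality using (_≡_; refl; sym; trans; cong; subst)
open import Relation.Binary.Definitions using (tri<; tri≈; tri>)

private
  variable
    a b p : Level
    A B P P₁ Q Q₁ : Set a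

¬¬-zipWith : ∀ {C : Set p} → (A → B → C) → ¬ ¬ A → ¬ ¬ B → ¬ ¬ C
¬¬-zipWith f ¬¬a ¬¬b ¬c = ¬¬a λ x → ¬¬b λ y → ¬c (f x y)

Iff : Set a → Set b → Set (a ⊔ b)
Iff P Q = (P → Q) × (Q → P)

Iff-transport : Iff P P₁ → Iff Q Q₁ → Iff P Q → Iff P₁ Q₁
Iff-transport (P→P₁ , P₁→P) (Q→Q₁ , Q₁→Q) (P→Q , Q→P) =
  Q→Q₁ ∘ P→Q ∘ P₁→P , P→P₁ ∘ Q→P ∘ Q₁→Q

Iff-stable : Dec P → Dec Q → ¬ ¬ Iff P Q → Iff P Q
Iff-stable P? Q? ¬¬iff =
    (λ p → decidable-stable Q? (¬¬-map (λ iff → proj₁ iff p) ¬¬iff))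
  , (λ q → decidable-stable P? (¬¬-map (λ iff → proj₂ iff q) ¬¬iff))

module _ {c ℓ₁ ℓ₂ : Level} (C : Configuration c ℓ₁ ℓ₂) where
  open Configuration C

  <-resp-≈-Iff : ∀ {x x₁ y y₁} → x ≈ x₁ → y ≈ y₁ → Iff (x < y) (x₁ < y₁)
  <-resp-≈-Iff x≈ y≈ =
      <-respˡ-≈ x≈ ∘ <-respʳ-≈ y≈
    , <-respˡ-≈ (Eq.sym x≈) ∘ <-respʳ-≈ (Eq.sym y≈)

  ≈-resp-≈-Iff : ∀ {x x₁ y y₁} → x ≈ x₁ → y ≈ y₁ → Iff (x ≈ y) (x₁ ≈ y₁)
  ≈-resp-≈-Iff x≈ y≈ =
      (λ e → Eq.trans (Eq.sym x≈) (Eq.trans e y≈))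
    , (λ e → Eq.trans x≈ (Eq.trans e (Eq.sym y≈)))

module _ {c ℓ₁ ℓ₂ c' ℓ₁' ℓ₂' : Level}
         (C : Configuration c ℓ₁ ℓ₂) (C' : Configuration c' ℓ₁' ℓ₂') where
  private
    module C = Configuration C
    module C' = Configuration C'

  -- IsValuationIso α f g unfolds to ∀ u v → SameOrdering (f u) (f v) (g (α u)) (g (α v)).
  SameOrdering : C.Carrier → C.Carrier → C'.Carrier → C'.Carrier → Set (ℓ₁ ⊔ ℓ₂ ⊔ ℓ₁' ⊔ ℓ₂')
  SameOrdering x y x' y' =
    Iff (x C.< y) (x' C'.< y') × Iff (x C.≈ y) (x' C'.≈ y') × Iff (y C.< x) (y' C'.< x')

  SameOrdering-resp-≈ : ∀ {x x₁ y y₁ x' x₁' y' y₁'} →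
    x C.≈ x₁ → y C.≈ y₁ → x' C'.≈ x₁' → y' C'.≈ y₁' →
    SameOrdering x y x' y' → SameOrdering x₁ y₁ x₁' y₁'
  SameOrdering-resp-≈ x≈ y≈ x'≈ y'≈ (lt , eq , gt) =
      Iff-transport (<-resp-≈-Iff C x≈ y≈) (<-resp-≈-Iff C' x'≈ y'≈) lt
    , Iff-transport (≈-resp-≈-Iff C x≈ y≈) (≈-resp-≈-Iff C' x'≈ y'≈) eq
    , Iff-transport (<-resp-≈-Iff C y≈ x≈) (<-resp-≈-Iff C' y'≈ x'≈) gt

  SameOrdering-stable : ∀ {x y x' y'} → ¬ ¬ SameOrdering x y x' y' → SameOrdering x y x' y'
  SameOrdering-stable {x} {y} {x'} {y'} ¬¬same =
      Iff-stable (x C.<? y) (x' C'.<? y') (¬¬-map proj₁ ¬¬same)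
    , Iff-stable (x C.≟ y) (x' C'.≟ y') (¬¬-map (proj₁ ∘ proj₂) ¬¬same)
    , Iff-stable (y C.<? x) (y' C'.<? x') (¬¬-map (proj₂ ∘ proj₂) ¬¬same)

module _ {n : ℕ} (G : SimpleDigraph n) where
  open SimpleDigraph G

  OutNeighbour : Fin n → Fin n → Set
  OutNeighbour v u = (¬ u ≡ v) × Edge v u

  module _ (α : Automorphism G) where
    open Automorphism α

    to-injective : ∀ {u v} → to u ≡ to v → u ≡ v
    to-injective {u} {v} e = trans (sym (from-to u)) (trans (cong from e) (from-to v))

    OutNeighbour-to : ∀ {v u} → OutNeighbour v u → OutNeighbour (to v) (to u)
    OutNeighbour-to {v} {u} (u≢v , e) = u≢v ∘ to-injective , proj₁ (edge⇔ v u) e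

    OutNeighbour-from : ∀ {v u} → OutNeighbour (to v) u → OutNeighbour v (from u)
    OutNeighbour-from {v} {u} (u≢tov , e) =
        (λ fromu≡v → u≢tov (trans (sym (to-from u)) (cong to fromu≡v)))
      , proj₂ (edge⇔ v (from u)) (subst (Edge (to v)) (sym (to-from u)) e)

    hasOutNeighbour-to : ∀ {v} → Σ (Fin n) (OutNeighbour v) → Σ (Fin n) (OutNeighbour (to v))
    hasOutNeighbour-to (u , out) = to u , OutNeighbour-to out

    hasOutNeighbour-from : ∀ {v} → Σ (Fin n) (OutNeighbour (to v)) → Σ (Fin n) (OutNeighbour v)
    hasOutNeighbour-from (u , out) = from u , OutNeighbour-from out

  module _ {c ℓ₁ ℓ₂ : Level} (C : Configuration c ℓ₁ ℓ₂) where
    open Configuration C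

    IsMaxOutNeighbour-unique : ∀ {f v m m'} →
      IsMaxOutNeighbour G C f v m → IsMaxOutNeighbour G C f v m' → m ≈ m'
    IsMaxOutNeighbour-unique {m = m} {m'} ((u , u≢v , e , m≈fu) , m-max) ((u' , u'≢v , e' , m'≈fu') , m'-max)
      with compare m m'
    ... | tri< m<m' _ _ = ⊥-elim (m-max u' u'≢v e' (<-respʳ-≈ m'≈fu' m<m'))
    ... | tri≈ _ m≈m' _ = m≈m'
    ... | tri> _ _ m'<m = ⊥-elim (m'-max u u≢v e (<-respʳ-≈ m≈fu m'<m))

  module _ {c ℓ₁ ℓ₂ c' ℓ₁' ℓ₂' : Level}
           (C : Configuration c ℓ₁ ℓ₂) (C' : Configuration c' ℓ₁' ℓ₂')
           (α : Automorphism G) (f : Valuation G C) (g : Valuation G C')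
           (iso : IsValuationIso G C C' α f g) where
    private
      module C = Configuration C
      module C' = Configuration C'
    open Automorphism α

    IsMaxOutNeighbour-to : ∀ {v m} → IsMaxOutNeighbour G C f v m →
      ∃ λ w → m C.≈ f w × IsMaxOutNeighbour G C' g (to v) (g (to w))
    IsMaxOutNeighbour-to {v} {m} ((w , w≢v , e , m≈fw) , m-max) =
      w , m≈fw , (to w , proj₁ tow-out , proj₂ tow-out , C'.Eq.refl) , gw-max
      where
      tow-out : OutNeighbour (to v) (to w)
      tow-out = OutNeighbour-to α (w≢v , e)
      gw-max : ∀ u → ¬ u ≡ to v → Edge (to v) u → ¬ g (to w) C'.< g u
      gw-max u u≢tov e gw<gu =
        m-max (from u) (proj₁ u-out) (proj₂ u-out)
          (C.<-respˡ-≈ (C.Eq.sym m≈fw) (proj₂ (proj₁ (iso w (from u))) gw<gtou))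
        where
        u-out : OutNeighbour v (from u)
        u-out = OutNeighbour-from α (u≢tov , e)
        gw<gtou : g (to w) C'.< g (to (from u))
        gw<gtou = subst (g (to w) C'.<_) (cong g (sym (to-from u))) gw<gu

    CopiesOldValue : Valuation G C → Valuation G C' → Fin n → Set (ℓ₁ ⊔ ℓ₁')
    CopiesOldValue f' g' v = ∃ λ w → f' v C.≈ f w × g' (to v) C'.≈ g (to w)

    update-copiesOldValue : ∀ {v' f' g'} →
      Update G C f v' f' → Update G C' g (to v') g' → ∀ v → ¬ ¬ CopiesOldValue f' g' v
    update-copiesOldValue {v'} {f'} {g'} uf ug v with v ≟ v'
    ... | no v≢v' = λ ¬copies →
      ¬copies (v , Update.others uf v v≢v' , Update.others ug (to v) (v≢v' ∘ to-injective α))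
    ... | yes refl = ¬¬-map copiesByCases ¬¬-excluded-middle
      where
      copiesByCases : Dec (HasOutNeighbour G C v) → CopiesOldValue f' g' v
      copiesByCases (no ¬out) =
        v , Update.withoutOut uf ¬out , Update.withoutOut ug (¬out ∘ hasOutNeighbour-from α)
      copiesByCases (yes out) with IsMaxOutNeighbour-to (Update.withOut uf out)
      ... | w , f'v≈fw , gw-max =
        w , f'v≈fw , IsMaxOutNeighbour-unique C' (Update.withOut ug (hasOutNeighbour-to α out)) gw-max

    IsValuationIso-transfer : ∀ f' g' → (∀ v → ¬ ¬ CopiesOldValue f' g' v) →
      IsValuationIso G C C' α f' g'
    IsValuationIso-transfer f' g' copies u v =
      SameOrdering-stable C C' (¬¬-zipWith sameAtCopies (copies u) (copies v))
      where
      sameAtCopies : CopiesOldValue f' g' u → CopiesOldValue f' g' v →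
        SameOrdering C C' (f' u) (f' v) (g' (to u)) (g' (to v))
      sameAtCopies (wu , fu≈ , gu≈) (wv , fv≈ , gv≈) =
        SameOrdering-resp-≈ C C' (C.Eq.sym fu≈) (C.Eq.sym fv≈) (C'.Eq.sym gu≈) (C'.Eq.sym gv≈)
          (iso wu wv)

mainTheorem16 : ∀ {c ℓ₁ ℓ₂ c' ℓ₁' ℓ₂' : Level} {n : ℕ} (G : SimpleDigraph n)
    (C : Configuration c ℓ₁ ℓ₂) (C' : Configuration c' ℓ₁' ℓ₂')
    (α : Automorphism G) (ft : Valuation G C) (gt : Valuation G C')
    → IsValuationIso G C C' α ft gt
    → (v' : Fin n) (ft+1 : Valuation G C) (gt+1 : Valuation G C')
    → Update G C ft v' ft+1
    → Update G C' gt (Automorphism.to α v') gt+1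
    → IsValuationIso G C C' α ft+1 gt+1 × _≡ᵥ_ G C C' ft+1 gt+1
mainTheorem16 G C C' α ft gt iso v' ft+1 gt+1 uf ug = iso+1 , α , iso+1
  where
  iso+1 : IsValuationIso G C C' α ft+1 gt+1
  iso+1 = IsValuationIso-transfer G C C' α ft gt iso ft+1 gt+1
    (update-copiesOldValue G C C' α ft gt iso uf ug)
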